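{- Let $(U_m)_{m\geq 1}$ be the sequence of Ulam numbers. Then for every $m>3$, the Ulam number $U_m$ is not the sum of its two immediately preceding Ulam numbers, i.e. $U_m\neq U_{m-1}+U_{m-2}$.
   Context: The Ulam numbers are defined by $U_1=1$, $U_2=2$, and for $i\geq 3$, $U_i$ is the smallest integer greater than $U_{i-1}$ that has exactly one representation as a sum $U_j+U_k$ of two distinct earlier Ulam numbers ($i-1\geq j>k\geq 1$). The sequence begins $1,2,3,4,6,8,11,\ldots$. -}

module Defs where

open import Data.Nat using (ℕ; zero; suc; _+_; _∸_; _<_; _≟_)
open import Data.List using (List; []; _∷_; applyUpTo)
open import Relation.Nullary using (¬_; yes; no)
open import Relation.Binary.PropositionalEquality using (_≡_)

countPartner : ℕ → ℕ → List ℕ → ℕ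
countPartner x n [] = 0
countPartner x n (y ∷ ys) with x + y ≟ n
... | yes _ = suc (countPartner x n ys)
... | no  _ = countPartner x n ys

reps : List ℕ → ℕ → ℕ
reps [] n = 0
reps (x ∷ xs) n = countPartner x n xs + reps xs n

-- the earlier terms u 1, …, u (i-1) of a 1-indexed sequence u
earlier : (ℕ → ℕ) → ℕ → List ℕ
earlier u i = applyUpTo (λ k → u (suc k)) (i ∸ 1)

ulamReps : (ℕ → ℕ) → ℕ → ℕ → ℕ
ulamReps u i n = reps (earlier u i) n

-- u (indexed from 1; u 0 is irrelevant) is the Ulam sequence:
-- U_1 = 1, U_2 = 2, and for i ≥ 3, U_i is the smallest integer greater
-- than U_{i-1} having exactly one representation U_j + U_k, i-1 ≥ j > k ≥ 1.
record IsUlam (u : ℕ → ℕ) : Set where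
  field
    u1 : u 1 ≡ 1
    u2 : u 2 ≡ 2
    greater  : ∀ i → 2 < i → u (i ∸ 1) < u i
    unique   : ∀ i → 2 < i → ulamReps u i (u i) ≡ 1
    smallest : ∀ i → 2 < i → ∀ n → u (i ∸ 1) < n → n < u i → ¬ (ulamReps u i n ≡ 1)

module Submission where

-- Suppose m = k + 4 and U_m = U_{m-1} + U_{m-2}.  Write
-- c = U_{m-3} < a = U_{m-2} < b = U_{m-1} and look at n = c + b.  Then
--   b < n < a + b = U_m,
-- and n has exactly one representation as a sum of two distinct earlier
-- terms U_1, …, U_{m-1}: every U_j with j < m-3 is below c and every
-- term is at most b, so a pair involving such a U_j sums to less than
-- c + b; among c, a, b the pair sums are c + a < n = c + b < a + b.
-- Hence n would be an Ulam number between U_{m-1} and U_m, contradicting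
-- the minimality of U_m.

open import Defs
open import Data.Nat using (ℕ; zero; suc; _+_; _∸_; _≤_; _<_; z≤n; s≤s; _≟_)
open import Data.Nat.Properties
  using (<-irrefl; <-trans; <-≤-trans; <⇒≤; ≤-refl; m≤n⇒m<n∨m≡n;
         +-comm; +-cancelˡ-≡; +-cancelʳ-≡; +-mono-<-≤; +-monoˡ-<; m<m+n)
open import Data.List using (List; []; _∷_; _++_; applyUpTo)
open import Data.List.Relation.Unary.All as All using (All; []; _∷_)
open import Data.List.Relation.Unary.All.Properties using (++⁺)
open import Data.Sum using (inj₁; inj₂)
open import Data.Empty using (⊥-elim)
open import Relation.Nullary using (yes; no)
open import Relation.Binary.PropositionalEquality
  using (_≡_; _≢_; refl; sym; cong; subst; module ≡-Reasoning)

countPartner-hit : ∀ x n y ys → x + y ≡ n →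
  countPartner x n (y ∷ ys) ≡ suc (countPartner x n ys)
countPartner-hit x n y ys e with x + y ≟ n
... | yes _ = refl
... | no ne = ⊥-elim (ne e)

countPartner-miss : ∀ x n y ys → x + y ≢ n →
  countPartner x n (y ∷ ys) ≡ countPartner x n ys
countPartner-miss x n y ys ne with x + y ≟ n
... | yes e = ⊥-elim (ne e)
... | no _ = refl

countPartner-none : ∀ x n ys → All (λ y → x + y ≢ n) ys → countPartner x n ys ≡ 0
countPartner-none x n [] [] = refl
countPartner-none x n (y ∷ ys) (ne ∷ nes) =
  subst (_≡ 0) (sym (countPartner-miss x n y ys ne)) (countPartner-none x n ys nes)

small-no-partner : ∀ {c b x} ys → x < c → All (_≤ b) ys → countPartner x (c + b) ys ≡ 0
small-no-partner {c} {b} {x} ys x<c ys≤b =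
  countPartner-none x (c + b) ys
    (All.map (λ y≤b e → <-irrefl e (+-mono-<-≤ x<c y≤b)) ys≤b)

reps-small-prefix : ∀ c b P T → c ≤ b → All (_< c) P → All (_≤ b) T →
  reps (P ++ T) (c + b) ≡ reps T (c + b)
reps-small-prefix c b [] T c≤b [] T≤b = refl
reps-small-prefix c b (x ∷ P) T c≤b (x<c ∷ P<c) T≤b = begin
  countPartner x (c + b) (P ++ T) + reps (P ++ T) (c + b)
    ≡⟨ cong (_+ reps (P ++ T) (c + b)) (small-no-partner (P ++ T) x<c P++T≤b) ⟩
  reps (P ++ T) (c + b)
    ≡⟨ reps-small-prefix c b P T c≤b P<c T≤b ⟩
  reps T (c + b) ∎
  where
  open ≡-Reasoning
  P++T≤b : All (_≤ b) (P ++ T)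
  P++T≤b = ++⁺ (All.map (λ y<c → <⇒≤ (<-≤-trans y<c c≤b)) P<c) T≤b

-- Among c < a < b, the sum c + b is represented exactly once
-- (c + a is too small and a + b too large).
reps-triple : ∀ c a b → c < a → a < b → reps (c ∷ a ∷ b ∷ []) (c + b) ≡ 1
reps-triple c a b c<a a<b
  rewrite countPartner-miss c (c + b) a (b ∷ []) (λ e → <-irrefl (+-cancelˡ-≡ c a b e) a<b)
        | countPartner-hit c (c + b) b [] refl
        | countPartner-miss a (c + b) b [] (λ e → <-irrefl (sym (+-cancelʳ-≡ b a c e)) c<a)
  = refl

applyUpTo-last3 : {A : Set} (f : ℕ → A) (k : ℕ) →
  applyUpTo f (3 + k) ≡ applyUpTo f k ++ (f k ∷ f (1 + k) ∷ f (2 + k) ∷ [])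
applyUpTo-last3 f zero = refl
applyUpTo-last3 f (suc k) = cong (f 0 ∷_) (applyUpTo-last3 (λ i → f (suc i)) k)

applyUpTo-all : ∀ {A : Set} {P : A → Set} (f : ℕ → A) n → (∀ i → i < n → P (f i)) →
  All P (applyUpTo f n)
applyUpTo-all f zero h = []
applyUpTo-all f (suc n) h =
  h 0 (s≤s z≤n) ∷ applyUpTo-all (λ i → f (suc i)) n (λ i i<n → h (suc i) (s≤s i<n))

module UlamSequence {u : ℕ → ℕ} (U : IsUlam u) where
  open IsUlam U

  step : ∀ j → u (suc j) < u (2 + j)
  step zero rewrite u1 | u2 = s≤s (s≤s z≤n)
  step (suc j) = greater (3 + j) (s≤s (s≤s (s≤s z≤n)))

  increasing : ∀ i j → i < j → u (suc i) < u (suc j)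
  increasing i (suc j) (s≤s i≤j) with m≤n⇒m<n∨m≡n i≤j
  ... | inj₁ i<j = <-trans (increasing i j i<j) (step j)
  ... | inj₂ refl = step j

  positive : ∀ i → 1 ≤ u (suc i)
  positive zero rewrite u1 = ≤-refl
  positive (suc i) = subst (_≤ u (2 + i)) u1 (<⇒≤ (increasing 0 (suc i) (s≤s z≤n)))

  unique-sum : ∀ k → ulamReps u (4 + k) (u (1 + k) + u (3 + k)) ≡ 1
  unique-sum k = begin
    reps (applyUpTo f (3 + k)) (c + b)
      ≡⟨ cong (λ L → reps L (c + b)) (applyUpTo-last3 f k) ⟩
    reps (applyUpTo f k ++ (c ∷ a ∷ b ∷ [])) (c + b)
      ≡⟨ reps-small-prefix c b (applyUpTo f k) (c ∷ a ∷ b ∷ []) c≤b below-c triple≤b ⟩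
    reps (c ∷ a ∷ b ∷ []) (c + b)
      ≡⟨ reps-triple c a b (step k) (step (1 + k)) ⟩
    1 ∎
    where
    open ≡-Reasoning
    f : ℕ → ℕ
    f i = u (suc i)
    c a b : ℕ
    c = u (1 + k)
    a = u (2 + k)
    b = u (3 + k)
    c≤b : c ≤ b
    c≤b = <⇒≤ (<-trans (step k) (step (1 + k)))
    below-c : All (_< c) (applyUpTo f k)
    below-c = applyUpTo-all f k (λ i i<k → increasing i k i<k)
    triple≤b : All (_≤ b) (c ∷ a ∷ b ∷ [])
    triple≤b = c≤b ∷ <⇒≤ (step (1 + k)) ∷ ≤-refl ∷ []

mainTheorem5 : (u : ℕ → ℕ) → IsUlam u →
    ∀ m → 3 < m → u m ≢ u (m ∸ 1) + u (m ∸ 2)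
mainTheorem5 u U (suc (suc (suc zero))) (s≤s (s≤s (s≤s ())))
mainTheorem5 u U (suc (suc (suc (suc k)))) _ um≡b+a =
  IsUlam.smallest U (4 + k) (s≤s (s≤s (s≤s z≤n))) n b<n n<um (unique-sum k)
  where
  open UlamSequence U
  n : ℕ
  n = u (1 + k) + u (3 + k)
  b<n : u (3 + k) < n
  b<n = subst (u (3 + k) <_) (+-comm (u (3 + k)) (u (1 + k))) (m<m+n (u (3 + k)) (positive k))
  n<um : n < u (4 + k)
  n<um = subst (n <_) (sym um≡b+a)
           (subst (n <_) (+-comm (u (2 + k)) (u (3 + k))) (+-monoˡ-< (u (3 + k)) (step k)))
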